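{- Let $k$ be an integer and $G_1,\dots,G_t$ connected graphs with $\mathrm{sipc}(G_i)\le k$ for all $i$, and let $G$ be a graph obtained from them by pairwise clique-sums (starting from $\{G_1,\dots,G_t\}$ and repeatedly replacing two graphs of the current collection by a clique-sum of them until one graph remains), so that each $G_i$ is a subgraph of $G$. Let $P$ be an isometric path of $G$ and $w$ a vertex of $G$ such that for some $i$, $V(P)\cap V(G_i)\neq\emptyset$ and $w\in V(G_i)$. Then the vertices of $P$ can be covered by $k+6$ many $w$-rooted isometric paths of $G$.
   Context: A clique-sum of graphs $A$ and $B$ containing cliques $C_A$, $C_B$ of equal positive size is obtained from the disjoint union of $A$ and $B$ by identifying $C_A$ with $C_B$ into one shared clique (no edges deleted). An isometric path is a shortest path; it is $w$-rooted if $w$ is one of its end-vertices. For a connected graph $F$ and $v\in V(F)$, $\mathrm{ipc}_v(F)$ is the minimum $m$ such that the vertices of every isometric path of $F$ can be covered by $m$ many $v$-rooted isometric paths of $F$, and $\mathrm{sipc}(F)=\max_{v}\mathrm{ipc}_v(F)$. -}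

module Defs where

open import Level using (0ℓ)
open import Data.Nat using (ℕ; suc; _≤_)
open import Data.Fin using (Fin)
open import Data.Bool using (Bool; T)
open import Data.Maybe using (just)
open import Data.List using (List; []; _∷_; [_]; _++_; length; head; last; allFin)
open import Data.List.Relation.Unary.Linked using (Linked)
open import Data.List.Relation.Unary.Unique.Propositional using (Unique)
open import Data.List.Relation.Unary.All using (All)
open import Data.List.Relation.Unary.Any using (Any; here; there)
open import Data.List.Membership.Propositional using (_∈_)
open import Data.List.Relation.Binary.Permutation.Propositional using (_↭_)
open import Data.Product using (Σ; ∃; ∃-syntax; _×_; _,_)
open import Data.Sum using (_⊎_; inj₁; inj₂)
open import Data.List.Membership.Propositional.Properties using (∈-++⁻)
open import Relation.Binary.PropositionalEquality using (_≡_; refl)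
open import Relation.Nullary using (¬_)
open import Function.Definitions using (Injective)

record Graph : Set where
  field
    n     : ℕ
    adj   : Fin n → Fin n → Bool
    sym   : ∀ u v → T (adj u v) → T (adj v u)
    irref : ∀ u → ¬ T (adj u u)

open Graph public

V : Graph → Set
V G = Fin (n G)

E : (G : Graph) → V G → V G → Set
E G u v = T (adj G u v)

IsPathFromTo : (G : Graph) → V G → V G → List (V G) → Set
IsPathFromTo G u v xs =
  Linked (E G) xs × Unique xs × head xs ≡ just u × last xs ≡ just v

IsIsometric : (G : Graph) → List (V G) → Set
IsIsometric G xs = Σ (V G) λ u → Σ (V G) λ v →
  IsPathFromTo G u v xs × (∀ ys → IsPathFromTo G u v ys → length xs ≤ length ys)

Rooted : (G : Graph) → V G → List (V G) → Set
Rooted G w xs = head xs ≡ just w ⊎ last xs ≡ just w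

Connected : Graph → Set
Connected G = ∀ (u v : V G) → ∃ λ xs → IsPathFromTo G u v xs

CoverableBy : (G : Graph) → V G → ℕ → List (V G) → Set
CoverableBy G w m P = Σ (List (List (V G))) λ ps →
  length ps ≤ m ×
  All (λ q → IsIsometric G q × Rooted G w q) ps ×
  (∀ {x} → x ∈ P → Any (x ∈_) ps)

IpcAtMost : (F : Graph) → V F → ℕ → Set
IpcAtMost F v k = ∀ P → IsIsometric F P → CoverableBy F v k P

-- sipc(F) = max_v ipc_v(F) ≤ k
SipcAtMost : Graph → ℕ → Set
SipcAtMost F k = ∀ v → IpcAtMost F v k

IsClique : (G : Graph) {c : ℕ} → (Fin c → V G) → Set
IsClique G f = Injective _≡_ _≡_ f × (∀ i j → ¬ i ≡ j → E G (f i) (f j))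

-- G is (isomorphic to) a clique-sum of A and B: G is the union of
-- embedded copies ιA(A), ιB(B) which overlap exactly in a clique
-- C_A of A identified (index-wise) with a clique C_B of B of the same
-- positive size, and G has exactly the edges of the two copies.
record IsCliqueSum (A B G : Graph) : Set where
  field
    ιA     : V A → V G
    ιB     : V B → V G
    ιA-inj : Injective _≡_ _≡_ ιA
    ιB-inj : Injective _≡_ _≡_ ιB
    cover  : ∀ v → (∃ λ a → ιA a ≡ v) ⊎ (∃ λ b → ιB b ≡ v)
    c      : ℕ
    CA     : Fin (suc c) → V A
    CB     : Fin (suc c) → V B
    CA-clq : IsClique A CA
    CB-clq : IsClique B CB
    glue   : ∀ i → ιA (CA i) ≡ ιB (CB i)
    meet   : ∀ a b → ιA a ≡ ιB b → ∃ λ i → a ≡ CA i × b ≡ CB i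
    edgeA  : ∀ a a' → E A a a' → E G (ιA a) (ιA a')
    edgeB  : ∀ b b' → E B b b' → E G (ιB b) (ιB b')
    edgeG  : ∀ u v → E G u v →
               (∃ λ a → ∃ λ a' → ιA a ≡ u × ιA a' ≡ v × E A a a')
             ⊎ (∃ λ b → ∃ λ b' → ιB b ≡ u × ιB b' ≡ v × E B b b')

-- Built Gs S G : G is obtained by pairwise clique-sums from the graphs
-- Gs i, i ∈ S (each leaf used once per occurrence in S).
data Built {t : ℕ} (Gs : Fin t → Graph) : List (Fin t) → Graph → Set where
  leaf : ∀ i → Built Gs [ i ] (Gs i)
  csum : ∀ {S₁ S₂ A B G} → Built Gs S₁ A → Built Gs S₂ B →
         IsCliqueSum A B G → Built Gs (S₁ ++ S₂) G

embed : ∀ {t} {Gs : Fin t → Graph} {S G} → Built Gs S G →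
        ∀ {i} → i ∈ S → V (Gs i) → V G
embed (leaf i) (here refl) x = x
embed (csum {S₁ = S₁} b₁ b₂ cs) m x with ∈-++⁻ S₁ m
... | inj₁ m₁ = IsCliqueSum.ιA cs (embed b₁ m₁ x)
... | inj₂ m₂ = IsCliqueSum.ιB cs (embed b₂ m₂ x)

record CliqueSumOf {t : ℕ} (Gs : Fin t → Graph) (G : Graph) : Set where
  field
    order : List (Fin t)
    perm  : order ↭ allFin t
    build : Built Gs order G

-- Each G_i sits in G as a piece: walks of G between its vertices retract onto it without getting
-- longer, and every outside vertex sees it through a clique (two walks from that vertex meeting G_i
-- only at their ends end at equal or adjacent vertices). Both sides of a clique-sum are pieces and
-- pieces compose, so this holds for every G_i.
--
-- Let d be the distance from w. Cut P at its first and its last vertex in G_i. The middle part is a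
-- shortest walk between vertices of G_i, so it stays inside G_i and is covered by k w-rooted
-- isometric paths of G_i. An end part Q from x to b satisfies d(b) + |Q| ≤ d(x) + 2, because the
-- geodesic from x to w enters G_i next to b; and a walk R from s to t with d(s) + |R| ≤ d(t) + c is
-- covered by c + 1 w-rooted geodesics, cut where d fails to increase. This gives 3 + k + 3 paths.

module Submission where

open import Defs
open import Data.Nat using (ℕ; zero; suc; _+_; _≤_; _<_; z≤n; s≤s; s≤s⁻¹; _≤?_)
open import Data.Nat.Properties
  using ( ≤-refl; ≤-trans; ≤-reflexive; m≤n⇒m≤1+n; m≤n+m; +-comm; +-suc; +-identityʳ
        ; +-mono-≤; +-monoˡ-≤; +-monoʳ-≤; +-cancelˡ-≤; +-cancelʳ-≤; ≮⇒≥; ≰⇒>; n≮n; suc-injective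
        ; anyUpTo?; module ≤-Reasoning )
open import Data.Nat.Induction using (<-rec)
open import Data.Nat.Tactic.RingSolver using (solve-∀)
open import Data.Fin using (Fin; zero)
open import Data.Fin.Properties using (_≟_; any?)
open import Data.Maybe as Maybe using (just)
open import Data.List as List using (List; []; _∷_; [_]; _++_; length; head; last)
open import Data.List.Properties using (length-++; length-map; head-map; last-map)
open import Data.List.Relation.Unary.Linked using (Linked; [-]; _∷_)
open import Data.List.Relation.Unary.All as All using (All; []; _∷_)
import Data.List.Relation.Unary.All.Properties as AllP
open import Data.List.Relation.Unary.Any as Any using (Any; here; there)
import Data.List.Relation.Unary.Any.Properties as AnyP
open import Data.List.Relation.Unary.AllPairs using ([]; _∷_)
open import Data.List.Relation.Unary.Unique.Propositional using (Unique)
open import Data.List.Membership.Propositional using (_∈_)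
open import Data.List.Membership.Propositional.Properties using (∈-++⁻; ∈-++⁺ˡ; ∈-++⁺ʳ; ∈-map⁺; ∈-map⁻)
open import Data.List.Relation.Binary.Subset.Propositional using (_⊆_)
open import Data.Product as Product using (Σ; ∃; _×_; _,_; proj₁; proj₂; uncurry)
open import Data.Sum as Sum using (_⊎_; inj₁; inj₂; [_,_]′)
open import Data.Empty using (⊥-elim)
open import Function using (_∘_; id)
open import Relation.Nullary using (¬_; Dec; yes; no)
open import Relation.Nullary.Decidable using (T?; _×-dec_)
open import Relation.Binary.PropositionalEquality as ≡ using (_≡_; refl; cong; cong₂; subst; subst₂; trans)

data Walk (G : Graph) : V G → V G → Set where
  nil  : ∀ u → Walk G u u
  cons : ∀ u {v w} → E G u v → Walk G v w → Walk G u w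

data Near (G : Graph) (u : V G) : V G → Set where
  same     : Near G u u
  adjacent : ∀ {v} → E G u v → Near G u v

module _ {G : Graph} where

  verts : ∀ {u v} → Walk G u v → List (V G)
  verts (nil u)      = [ u ]
  verts (cons u _ W) = u ∷ verts W

  len : ∀ {u v} → Walk G u v → ℕ
  len (nil _)      = 0
  len (cons _ _ W) = suc (len W)

  length-verts : ∀ {u v} (W : Walk G u v) → length (verts W) ≡ suc (len W)
  length-verts (nil _)      = refl
  length-verts (cons _ _ W) = cong suc (length-verts W)

  source∈ : ∀ {u v} (W : Walk G u v) → u ∈ verts W
  source∈ (nil _)      = here refl
  source∈ (cons _ _ _) = here refl

  target∈ : ∀ {u v} (W : Walk G u v) → v ∈ verts W
  target∈ (nil _)      = here refl
  target∈ (cons _ _ W) = there (target∈ W)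

  len-pos : ∀ {u v} → ¬ u ≡ v → (W : Walk G u v) → 0 < len W
  len-pos u≢u (nil _)      = ⊥-elim (u≢u refl)
  len-pos _   (cons _ _ _) = s≤s z≤n

  step : ∀ {u v} → E G u v → Walk G u v
  step {u} {v} e = cons u e (nil v)

  near-walk : ∀ {u v} → Near G u v → Σ (Walk G u v) λ J → len J ≤ 1
  near-walk same         = nil _ , z≤n
  near-walk (adjacent e) = step e , ≤-refl

  near-sym : ∀ {u v} → Near G u v → Near G v u
  near-sym same         = same
  near-sym (adjacent e) = adjacent (sym G _ _ e)

  infixr 5 _++ᵂ_
  _++ᵂ_ : ∀ {u v w} → Walk G u v → Walk G v w → Walk G u w
  nil _      ++ᵂ W' = W'
  cons u e W ++ᵂ W' = cons u e (W ++ᵂ W')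

  len-++ : ∀ {u v w} (W : Walk G u v) (W' : Walk G v w) → len (W ++ᵂ W') ≡ len W + len W'
  len-++ (nil _)      W' = refl
  len-++ (cons _ _ W) W' = cong suc (len-++ W W')

  ∈-++ᵂ⁻ : ∀ {u v w x} (W : Walk G u v) (W' : Walk G v w) →
           x ∈ verts (W ++ᵂ W') → x ∈ verts W ⊎ x ∈ verts W'
  ∈-++ᵂ⁻ (nil _)      W' x∈         = inj₂ x∈
  ∈-++ᵂ⁻ (cons _ _ W) W' (here p)   = inj₁ (here p)
  ∈-++ᵂ⁻ (cons _ _ W) W' (there x∈) = Sum.map₁ there (∈-++ᵂ⁻ W W' x∈)

  ∈-++ᵂ⁺ˡ : ∀ {u v w x} (W : Walk G u v) (W' : Walk G v w) → x ∈ verts W → x ∈ verts (W ++ᵂ W')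
  ∈-++ᵂ⁺ˡ (nil _)      W' (here refl) = source∈ W'
  ∈-++ᵂ⁺ˡ (cons _ _ W) W' (here p)    = here p
  ∈-++ᵂ⁺ˡ (cons _ _ W) W' (there x∈)  = there (∈-++ᵂ⁺ˡ W W' x∈)

  ∈-++ᵂ⁺ʳ : ∀ {u v w x} (W : Walk G u v) (W' : Walk G v w) → x ∈ verts W' → x ∈ verts (W ++ᵂ W')
  ∈-++ᵂ⁺ʳ (nil _)      W' x∈ = x∈
  ∈-++ᵂ⁺ʳ (cons _ _ W) W' x∈ = there (∈-++ᵂ⁺ʳ W W' x∈)

  reverse : ∀ {u v} → Walk G u v → Walk G v u
  reverse (nil u)          = nil u
  reverse (cons u {v} e W) = reverse W ++ᵂ step (sym G u v e)

  len-reverse : ∀ {u v} (W : Walk G u v) → len (reverse W) ≡ len W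
  len-reverse (nil _)      = refl
  len-reverse (cons _ _ W) =
    trans (len-++ (reverse W) _) (trans (+-comm (len (reverse W)) 1) (cong suc (len-reverse W)))

  ∈-reverse : ∀ {u v x} (W : Walk G u v) → x ∈ verts W → x ∈ verts (reverse W)
  ∈-reverse (nil _)      x∈          = x∈
  ∈-reverse (cons _ _ W) (here refl) = ∈-++ᵂ⁺ʳ (reverse W) _ (there (here refl))
  ∈-reverse (cons _ _ W) (there x∈)  = ∈-++ᵂ⁺ˡ (reverse W) _ (∈-reverse W x∈)

  splitAt : ∀ {u v x} (W : Walk G u v) → x ∈ verts W →
            Σ (Walk G u x) λ W₁ → Σ (Walk G x v) λ W₂ → W ≡ W₁ ++ᵂ W₂
  splitAt (nil u)      (here refl) = nil u , nil u , refl
  splitAt (cons u e W) (here refl) = nil u , cons u e W , refl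
  splitAt (cons u e W) (there x∈) with W₁ , W₂ , refl ← splitAt W x∈ = cons u e W₁ , W₂ , refl

  Shortest : ∀ {u v} → Walk G u v → Set
  Shortest {u} {v} W = ∀ (W' : Walk G u v) → len W ≤ len W'

  shortest-++ˡ : ∀ {u v w} (W : Walk G u v) (W' : Walk G v w) → Shortest (W ++ᵂ W') → Shortest W
  shortest-++ˡ W W' sh W₁ =
    +-cancelʳ-≤ (len W') (len W) (len W₁) (subst₂ _≤_ (len-++ W W') (len-++ W₁ W') (sh (W₁ ++ᵂ W')))

  shortest-++ʳ : ∀ {u v w} (W : Walk G u v) (W' : Walk G v w) → Shortest (W ++ᵂ W') → Shortest W'
  shortest-++ʳ W W' sh W₁ =
    +-cancelˡ-≤ (len W) (len W') (len W₁) (subst₂ _≤_ (len-++ W W') (len-++ W W₁) (sh (W ++ᵂ W₁)))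

  shortest-reverse : ∀ {u v} (W : Walk G u v) → Shortest W → Shortest (reverse W)
  shortest-reverse W sh W' = subst₂ _≤_ (≡.sym (len-reverse W)) (len-reverse W') (sh (reverse W'))

  source∉-shortest : ∀ {u v w} (e : E G u v) (W : Walk G v w) → Shortest (cons u e W) → ¬ u ∈ verts W
  source∉-shortest e W sh u∈W with W₁ , W₂ , refl ← splitAt W u∈W =
    n≮n _ (≤-trans (sh W₂) (≤-trans (m≤n+m (len W₂) (len W₁)) (≤-reflexive (≡.sym (len-++ W₁ W₂)))))

  shortest-unique : ∀ {u v} (W : Walk G u v) → Shortest W → Unique (verts W)
  shortest-unique (nil _)      _  = [] ∷ []
  shortest-unique (cons u e W) sh =
    All.tabulate (λ { u∈W refl → source∉-shortest e W sh u∈W }) ∷ shortest-unique W (shortest-++ʳ (step e) W sh)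

  WalkOfLength : ℕ → V G → V G → Set
  WalkOfLength l u v = Σ (Walk G u v) λ W → len W ≡ l

  walkOfLength? : ∀ l u v → Dec (WalkOfLength l u v)
  walkOfLength? zero u v with u ≟ v
  ... | yes refl = yes (nil u , refl)
  ... | no u≢v   = no λ { (nil _ , _) → u≢v refl ; (cons _ _ _ , ()) }
  walkOfLength? (suc l) u v with any? (λ z → T? (adj G u z) ×-dec walkOfLength? l z v)
  ... | yes (_ , e , W , refl) = yes (cons u e W , refl)
  ... | no ∄ = no λ { (nil _ , ()) ; (cons _ e W , len≡) → ∄ (_ , e , W , suc-injective len≡) }

  shortest-exists : ∀ {u v} → Walk G u v → Σ (Walk G u v) Shortest
  shortest-exists {u} {v} W = <-rec Goal go (len W) W refl
    where
    Goal : ℕ → Set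
    Goal n = (W : Walk G u v) → len W ≡ n → Σ (Walk G u v) Shortest
    go : ∀ n → (∀ {m} → m < n → Goal m) → Goal n
    go n shorter W refl with anyUpTo? (λ l → walkOfLength? l u v) n
    ... | yes (_ , m<n , W' , len≡) = shorter m<n W' len≡
    ... | no ∄ = W , λ W' → ≮⇒≥ (λ W'<W → ∄ (len W' , W'<W , W' , refl))

module _ {G : Graph} where

  verts-linked : ∀ {u v} (W : Walk G u v) → Linked (E G) (verts W)
  verts-linked (nil _)                  = [-]
  verts-linked (cons _ e (nil _))       = e ∷ [-]
  verts-linked (cons _ e W@(cons _ _ _)) = e ∷ verts-linked W

  head-verts : ∀ {u v} (W : Walk G u v) → head (verts W) ≡ just u
  head-verts (nil _)      = refl
  head-verts (cons _ _ _) = refl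

  last-verts : ∀ {u v} (W : Walk G u v) → last (verts W) ≡ just v
  last-verts (nil _)                   = refl
  last-verts (cons _ _ (nil _))        = refl
  last-verts (cons _ _ W@(cons _ _ _)) = last-verts W

  fromPath : ∀ {u v} xs → Linked (E G) xs → head xs ≡ just u → last xs ≡ just v →
             Σ (Walk G u v) λ W → verts W ≡ xs
  fromPath (x ∷ [])     [-]      refl refl = nil x , refl
  fromPath (x ∷ y ∷ ys) (e ∷ lk) refl l with W , eq ← fromPath (y ∷ ys) lk refl l = cons x e W , cong (x ∷_) eq

  shortest⇒path : ∀ {u v} (W : Walk G u v) → Shortest W → IsPathFromTo G u v (verts W)
  shortest⇒path W sh = verts-linked W , shortest-unique W sh , head-verts W , last-verts W

  shortest⇒isometric : ∀ {u v} (W : Walk G u v) → Shortest W → IsIsometric G (verts W)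
  shortest⇒isometric {u} {v} W sh = u , v , shortest⇒path W sh , minimal
    where
    minimal : ∀ ys → IsPathFromTo G u v ys → length (verts W) ≤ length ys
    minimal ys (lk , _ , h , l) with W' , refl ← fromPath ys lk h l =
      subst₂ _≤_ (≡.sym (length-verts W)) (≡.sym (length-verts W')) (s≤s (sh W'))

  isometric⇒shortest : ∀ {xs} → IsIsometric G xs →
    Σ (V G) λ u → Σ (V G) λ v → Σ (Walk G u v) λ W → verts W ≡ xs × Shortest W
  isometric⇒shortest (u , v , (lk , _ , h , l) , minimal) with W , refl ← fromPath _ lk h l =
    u , v , W , refl , shortest
    where
    shortest : Shortest W
    shortest W' with Wₛ , Wₛ-shortest ← shortest-exists W' =
      ≤-trans (s≤s⁻¹ (subst₂ _≤_ (length-verts W) (length-verts Wₛ) (minimal _ (shortest⇒path Wₛ Wₛ-shortest))))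
              (Wₛ-shortest W')

connected-walk : ∀ {G} → Connected G → ∀ u v → Walk G u v
connected-walk connected u v with xs , lk , _ , h , l ← connected u v = proj₁ (fromPath xs lk h l)

module Covering (G : Graph) (w : V G) where

  coverable-≤ : ∀ {m n xs} → m ≤ n → CoverableBy G w m xs → CoverableBy G w n xs
  coverable-≤ m≤n (ps , ps≤m , good , covers) = ps , ≤-trans ps≤m m≤n , good , covers

  coverable-⊆ : ∀ {m xs ys} → xs ⊆ ys → CoverableBy G w m ys → CoverableBy G w m xs
  coverable-⊆ xs⊆ys (ps , ps≤m , good , covers) = ps , ps≤m , good , covers ∘ xs⊆ys

  coverable-++ : ∀ {m n} xs {ys} → CoverableBy G w m xs → CoverableBy G w n ys →
                 CoverableBy G w (m + n) (xs ++ ys)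
  coverable-++ xs (ps , ps≤m , good , covers) (qs , qs≤n , good' , covers') =
    ps ++ qs , ≤-trans (≤-reflexive (length-++ ps)) (+-mono-≤ ps≤m qs≤n) , AllP.++⁺ good good' ,
    [ AnyP.++⁺ˡ ∘ covers , AnyP.++⁺ʳ ps ∘ covers' ]′ ∘ ∈-++⁻ xs

module Distance {G : Graph} (walk : ∀ u v → Walk G u v) (w : V G) where

  open Covering G w

  geodesic : ∀ v → Walk G w v
  geodesic v = proj₁ (shortest-exists (walk w v))

  d : V G → ℕ
  d v = len (geodesic v)

  d-minimal : ∀ {v} (R : Walk G w v) → d v ≤ len R
  d-minimal {v} = proj₂ (shortest-exists (walk w v))

  d-triangle : ∀ {s t} (R : Walk G s t) → d t ≤ d s + len R
  d-triangle {s} R = ≤-trans (d-minimal (geodesic s ++ᵂ R)) (≤-reflexive (len-++ (geodesic s) R))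

  coverable-geodesic : ∀ {s} (T : Walk G w s) → len T ≤ d s → CoverableBy G w 1 (verts T)
  coverable-geodesic T T≤d =
    [ verts T ] , ≤-refl ,
    (shortest⇒isometric T (λ T' → ≤-trans T≤d (d-minimal T')) , inj₁ (head-verts T)) ∷ [] , here

  len-snoc : ∀ {s s'} (T : Walk G w s) (e : E G s s') → len (T ++ᵂ step e) ≡ suc (len T)
  len-snoc T e = trans (len-++ T (step e)) (+-comm (len T) 1)

  -- The geodesic T is extended along R while d increases; every step where it does not starts a
  -- new geodesic and uses up one unit of the excess c.
  coverable-along : ∀ c {s t} (T : Walk G w s) (R : Walk G s t) → len T ≤ d s → len T + len R ≤ d t + c →
                    CoverableBy G w (suc c) (verts T ++ verts R)
  coverable-along c T (nil _) T-geodesic _ =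
    coverable-⊆ ([ id , (λ { (here refl) → target∈ T }) ]′ ∘ ∈-++⁻ (verts T))
                (coverable-≤ (s≤s z≤n) (coverable-geodesic T T-geodesic))
  coverable-along c T (cons _ {s'} e R) T-geodesic excess with d s' ≤? len T
  coverable-along c {t = t} T (cons _ e R) T-geodesic excess | no ascends =
    coverable-⊆ covered
      (coverable-along c (T ++ᵂ step e) R (≤-trans (≤-reflexive (len-snoc T e)) (≰⇒> ascends))
                       (subst (_≤ d t + c) (trans (+-suc (len T) (len R)) (cong (_+ len R) (≡.sym (len-snoc T e)))) excess))
    where
    covered : verts T ++ verts (cons _ e R) ⊆ verts (T ++ᵂ step e) ++ verts R
    covered x∈ with ∈-++⁻ (verts T) x∈
    ... | inj₁ x∈T         = ∈-++⁺ˡ (∈-++ᵂ⁺ˡ T (step e) x∈T)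
    ... | inj₂ (here refl) = ∈-++⁺ˡ (∈-++ᵂ⁺ˡ T (step e) (target∈ T))
    ... | inj₂ (there x∈R) = ∈-++⁺ʳ _ x∈R
  coverable-along zero {t = t} T (cons _ e R) _ excess | yes nearer = ⊥-elim (n≮n (d t) (begin-strict
    d t                   ≤⟨ d-triangle R ⟩
    d _ + len R           ≤⟨ +-monoˡ-≤ (len R) nearer ⟩
    len T + len R         <⟨ ≤-reflexive (≡.sym (+-suc (len T) (len R))) ⟩
    len T + suc (len R)   ≤⟨ excess ⟩
    d t + 0               ≡⟨ +-identityʳ (d t) ⟩
    d t                   ∎))
    where open ≤-Reasoning
  coverable-along (suc c) {t = t} T (cons _ {s'} e R) T-geodesic excess | yes nearer =
    coverable-⊆ covered
      (coverable-++ (verts T) (coverable-geodesic T T-geodesic) (coverable-along c (geodesic s') R ≤-refl excess'))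
    where
    open ≤-Reasoning
    excess' : d s' + len R ≤ d t + c
    excess' = begin
      d s' + len R   ≤⟨ +-monoˡ-≤ (len R) nearer ⟩
      len T + len R  ≤⟨ s≤s⁻¹ (subst₂ _≤_ (+-suc (len T) (len R)) (+-suc (d t) c) excess) ⟩
      d t + c        ∎
    covered : verts T ++ verts (cons _ e R) ⊆ verts T ++ verts (geodesic s') ++ verts R
    covered x∈ with ∈-++⁻ (verts T) x∈
    ... | inj₁ x∈T         = ∈-++⁺ˡ x∈T
    ... | inj₂ (here refl) = ∈-++⁺ˡ (target∈ T)
    ... | inj₂ (there x∈R) = ∈-++⁺ʳ (verts T) (∈-++⁺ʳ (verts (geodesic s')) x∈R)

  coverable-by-excess : ∀ c {s t} (R : Walk G s t) → d s + len R ≤ d t + c → CoverableBy G w (suc c) (verts R)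
  coverable-by-excess c {s} R excess =
    coverable-⊆ (∈-++⁺ʳ (verts (geodesic s))) (coverable-along c (geodesic s) R ≤-refl excess)

InImage : ∀ {k m} → (Fin k → Fin m) → Fin m → Set
InImage f x = ∃ λ a → f a ≡ x

inImage? : ∀ {k m} (f : Fin k → Fin m) x → Dec (InImage f x)
inImage? f x = any? (λ a → f a ≟ x)

module _ {G : Graph} {k : ℕ} (f : Fin k → V G) where

  MeetsOnlyAtEnd : ∀ {x c} → Walk G x (f c) → Set
  MeetsOnlyAtEnd {c = c} Z = ∀ {z} → z ∈ verts Z → InImage f z → z ≡ f c

  meets-cons : ∀ {u v c} {e : E G u v} {Z : Walk G v (f c)} →
               ¬ InImage f u → MeetsOnlyAtEnd Z → MeetsOnlyAtEnd (cons u e Z)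
  meets-cons u∉ _    (here refl) u∈ = ⊥-elim (u∉ u∈)
  meets-cons _  only (there z∈)  z∈f = only z∈ z∈f

  meets-++ʳ : ∀ {x y c} (Z₁ : Walk G x y) (Z₂ : Walk G y (f c)) →
              MeetsOnlyAtEnd (Z₁ ++ᵂ Z₂) → MeetsOnlyAtEnd Z₂
  meets-++ʳ Z₁ Z₂ only z∈ = only (∈-++ᵂ⁺ʳ Z₁ Z₂ z∈)

  first-entry : ∀ {x z} (Z : Walk G x z) → ∃ (λ c → f c ∈ verts Z) →
                ∃ λ c → Σ (Walk G x (f c)) λ Z₁ → Σ (Walk G (f c) z) λ Z₂ →
                  MeetsOnlyAtEnd Z₁ × Z ≡ Z₁ ++ᵂ Z₂
  first-entry (nil _) (c , here refl) = c , nil (f c) , nil (f c) , (λ { (here refl) _ → refl }) , refl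
  first-entry (cons x e Z) hit with inImage? f x | hit
  ... | yes (c , refl) | _ = c , nil (f c) , cons (f c) e Z , (λ { (here refl) _ → refl }) , refl
  ... | no x∉ | c , here refl = ⊥-elim (x∉ (c , refl))
  ... | no x∉ | c , there c∈Z with c' , Z₁ , Z₂ , only , refl ← first-entry Z (c , c∈Z) =
    c' , cons x e Z₁ , Z₂ , meets-cons {e = e} x∉ only , refl

record Shortcut {H G : Graph} (f : V H → V G) {a b u v} (Wʰ : Walk H a b) (W : Walk G u v) : Set where
  constructor shortcut
  field
    shorter : len Wʰ ≤ len W
    along   : ∀ {z} → z ∈ verts Wʰ → f z ∈ verts W

module _ {H G : Graph} {f : V H → V G} where

  shortcut-there : ∀ {a b u v w} {e : E G u v} {Wʰ : Walk H a b} {W : Walk G v w} →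
                   Shortcut f Wʰ W → Shortcut f Wʰ (cons u e W)
  shortcut-there (shortcut shorter along) = shortcut (m≤n⇒m≤1+n shorter) (there ∘ along)

  near-shortcut : ∀ {a a' b v w} → Near H a a' → (e : E G (f a) v) {W : Walk G v w} →
                  Σ (Walk H a' b) (λ Wʰ → Shortcut f Wʰ W) →
                  Σ (Walk H a b) (λ Wʰ → Shortcut f Wʰ (cons (f a) e W))
  near-shortcut same          _ (Wʰ , sc)                        = Wʰ , shortcut-there sc
  near-shortcut (adjacent e') _ (Wʰ , shortcut shorter along) =
    cons _ e' Wʰ , shortcut (s≤s shorter) λ { (here refl) → here refl ; (there z∈) → there (along z∈) }

map-walk : ∀ {H} G (f : V H → V G) → (∀ a b → E H a b → E G (f a) (f b)) →
           ∀ {a b} → Walk H a b → Walk G (f a) (f b)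
map-walk G f f-edge (nil a)      = nil (f a)
map-walk G f f-edge (cons a e W) = cons (f a) (f-edge a _ e) (map-walk G f f-edge W)

module _ {H : Graph} (G : Graph) (f : V H → V G) (f-edge : ∀ a b → E H a b → E G (f a) (f b)) where

  len-map-walk : ∀ {a b} (W : Walk H a b) → len (map-walk G f f-edge W) ≡ len W
  len-map-walk (nil _)      = refl
  len-map-walk (cons _ _ W) = cong suc (len-map-walk W)

  verts-map-walk : ∀ {a b} (W : Walk H a b) → verts (map-walk G f f-edge W) ≡ List.map f (verts W)
  verts-map-walk (nil _)      = refl
  verts-map-walk (cons a _ W) = cong (f a ∷_) (verts-map-walk W)

record IsPiece (H G : Graph) (f : V H → V G) : Set where
  field
    injective        : ∀ {a b} → f a ≡ f b → a ≡ b
    edge⁺            : ∀ a b → E H a b → E G (f a) (f b)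
    retract          : ∀ a b (W : Walk G (f a) (f b)) → Σ (Walk H a b) λ Wʰ → Shortcut f Wʰ W
    entries-adjacent : ∀ {x} c c' → ¬ InImage f x →
                       (Z : Walk G x (f c)) → MeetsOnlyAtEnd f Z →
                       (Z' : Walk G x (f c')) → MeetsOnlyAtEnd f Z' → Near H c c'

module Piece {H G : Graph} {f : V H → V G} (piece : IsPiece H G f) where
  open IsPiece piece

  edge⁻ : ∀ a b → E G (f a) (f b) → E H a b
  edge⁻ a b e with retract a b (step e)
  ... | nil _ , _                                 = ⊥-elim (irref G (f a) e)
  ... | cons _ e' (nil _) , _                     = e'
  ... | cons _ _ (cons _ _ _) , shortcut (s≤s ()) _

  near⁺ : ∀ {a b} → Near H a b → Near G (f a) (f b)
  near⁺ same                 = same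
  near⁺ {a} {b} (adjacent e) = adjacent (edge⁺ a b e)

  near⁻ : ∀ {a b u v} → f a ≡ u → f b ≡ v → Near G u v → Near H a b
  near⁻ p    q    same with refl ← injective (trans p (≡.sym q)) = same
  near⁻ refl refl (adjacent e) = adjacent (edge⁻ _ _ e)

  mapᴾ : ∀ {a b} → Walk H a b → Walk G (f a) (f b)
  mapᴾ = map-walk G f edge⁺

  map-shortest : ∀ {a b} (W : Walk H a b) → Shortest W → Shortest (mapᴾ W)
  map-shortest {a} {b} W sh W' with Wʰ , shortcut shorter _ ← retract a b W' =
    ≤-trans (≤-reflexive (len-map-walk G f edge⁺ W)) (≤-trans (sh Wʰ) shorter)

  isometric-map : ∀ {q} → IsIsometric H q → IsIsometric G (List.map f q)
  isometric-map iso with _ , _ , W , refl , sh ← isometric⇒shortest {G = H} iso =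
    subst (IsIsometric G) (verts-map-walk G f edge⁺ W) (shortest⇒isometric (mapᴾ W) (map-shortest W sh))

  rooted-map : ∀ {y q} → Rooted H y q → Rooted G (f y) (List.map f q)
  rooted-map {q = q} (inj₁ h) = inj₁ (trans (head-map {f = f} q) (cong (Maybe.map f) h))
  rooted-map {q = q} (inj₂ l) = inj₂ (trans (last-map f q) (cong (Maybe.map f) l))

  coverable-map : ∀ {y m q} → CoverableBy H y m q → CoverableBy G (f y) m (List.map f q)
  coverable-map {q = q} (ps , ps≤m , good , covers) =
    List.map (List.map f) ps , ≤-trans (≤-reflexive (length-map (List.map f) ps)) ps≤m ,
    AllP.map⁺ (All.map (Product.map isometric-map rooted-map) good) , covers-map
    where
    covers-map : ∀ {x} → x ∈ List.map f q → Any (x ∈_) (List.map (List.map f) ps)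
    covers-map x∈ with _ , z∈q , refl ← ∈-map⁻ f x∈ = AnyP.map⁺ (Any.map (∈-map⁺ f) (covers z∈q))

  lift : ∀ a b {u v} → f a ≡ u → f b ≡ v → (M : Walk G u v) → (∀ {z} → z ∈ verts M → InImage f z) →
         Σ (Walk H a b) λ Mʰ → len Mʰ ≡ len M × verts M ≡ List.map f (verts Mʰ)
  lift a b p q (nil _) _ with refl ← injective (trans p (≡.sym q)) = nil a , refl , cong [_] (≡.sym p)
  lift a b refl q (cons _ e M) inside with b' , refl ← inside (there (source∈ M))
    with Mʰ , len≡ , verts≡ ← lift b' b refl q M (inside ∘ there) =
    cons a (edge⁻ a b' e) Mʰ , cong suc len≡ , cong (f a ∷_) verts≡

  lift-shortest : ∀ {a b} (Mʰ : Walk H a b) (M : Walk G (f a) (f b)) → len Mʰ ≡ len M → Shortest M → Shortest Mʰ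
  lift-shortest Mʰ M len≡ sh Mʰ' =
    ≤-trans (≤-reflexive len≡) (≤-trans (sh (mapᴾ Mʰ')) (≤-reflexive (len-map-walk G f edge⁺ Mʰ')))

  toward : ∀ {a a' c} → Near G a a' → ¬ InImage f a → (Y : Walk G a' (f c)) → MeetsOnlyAtEnd f Y →
           Σ (Walk G a (f c)) (MeetsOnlyAtEnd f)
  toward same         _  Y only = Y , only
  toward (adjacent e) a∉ Y only = cons _ e Y , meets-cons f {e = e} a∉ only

  entries-near : ∀ {a a'} c c' → Near G a a' →
                 (Y : Walk G a (f c)) → MeetsOnlyAtEnd f Y → (Y' : Walk G a' (f c')) → MeetsOnlyAtEnd f Y' →
                 Near H c c'
  entries-near {a} {a'} c c' near Y only Y' only' with inImage? f a | inImage? f a'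
  ... | no a∉ | _ =
    uncurry (entries-adjacent c c' a∉ Y only) (toward near a∉ Y' only')
  ... | yes _ | no a'∉ =
    near-sym (uncurry (entries-adjacent c' c a'∉ Y' only') (toward (near-sym near) a'∉ Y only))
  ... | yes (h , p) | yes (h' , p') =
    near⁻ (≡.sym (only (source∈ Y) (h , p))) (≡.sym (only' (source∈ Y') (h' , p'))) near

id-piece : ∀ {G} → IsPiece G G id
id-piece = record
  { injective        = id
  ; edge⁺            = λ _ _ e → e
  ; retract          = λ _ _ W → W , shortcut ≤-refl id
  ; entries-adjacent = λ {x} _ _ x∉ _ _ _ _ → ⊥-elim (x∉ (x , refl))
  }

∘-piece : ∀ {H A G} {f : V H → V A} {g : V A → V G} → IsPiece H A f → IsPiece A G g → IsPiece H G (g ∘ f)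
∘-piece {H} {A} {G} {f} {g} pf pg = record
  { injective        = F.injective ∘ 𝔾.injective
  ; edge⁺            = λ a b → 𝔾.edge⁺ (f a) (f b) ∘ F.edge⁺ a b
  ; retract          = retract
  ; entries-adjacent = entries-adjacent
  }
  where
  module F = IsPiece pf
  module 𝔾 = IsPiece pg

  retract : ∀ a b (W : Walk G (g (f a)) (g (f b))) → Σ (Walk H a b) λ Wʰ → Shortcut (g ∘ f) Wʰ W
  retract a b W with Wᴬ , shortcut shorterᴬ alongᴬ ← 𝔾.retract (f a) (f b) W
    with Wʰ , shortcut shorterʰ alongʰ ← F.retract a b Wᴬ =
    Wʰ , shortcut (≤-trans shorterʰ shorterᴬ) (alongᴬ ∘ alongʰ)

  lower : ∀ a c (Z : Walk G (g a) (g (f c))) → MeetsOnlyAtEnd (g ∘ f) Z → Σ (Walk A a (f c)) (MeetsOnlyAtEnd f)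
  lower a c Z only with Y , shortcut _ along ← 𝔾.retract a (f c) Z =
    Y , λ { z∈ (h , refl) → 𝔾.injective (only (along z∈) (h , refl)) }

  entries-adjacent : ∀ {x} c c' → ¬ InImage (g ∘ f) x →
                     (Z : Walk G x (g (f c))) → MeetsOnlyAtEnd (g ∘ f) Z →
                     (Z' : Walk G x (g (f c'))) → MeetsOnlyAtEnd (g ∘ f) Z' → Near H c c'
  entries-adjacent {x} c c' x∉ Z only Z' only' with inImage? g x
  ... | yes (a , refl) with Y , onlyY ← lower a c Z only | Y' , onlyY' ← lower a c' Z' only' =
    F.entries-adjacent c c' (λ { (h , refl) → x∉ (h , refl) }) Y onlyY Y' onlyY'
  ... | no x∉g with a₁ , Z₁ , Z₂ , only₁ , refl ← first-entry g Z (f c , target∈ Z)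
                  | a₁' , Z₁' , Z₂' , only₁' , refl ← first-entry g Z' (f c' , target∈ Z')
    with Y , onlyY ← lower a₁ c Z₂ (meets-++ʳ (g ∘ f) Z₁ Z₂ only)
       | Y' , onlyY' ← lower a₁' c' Z₂' (meets-++ʳ (g ∘ f) Z₁' Z₂' only') =
    Piece.entries-near pf c c' (𝔾.entries-adjacent a₁ a₁' x∉g Z₁ only₁ Z₁' only₁') Y onlyY Y' onlyY'

swap : ∀ {A B G} → IsCliqueSum A B G → IsCliqueSum B A G
swap cs = record
  { ιA = ιB ; ιB = ιA ; ιA-inj = ιB-inj ; ιB-inj = ιA-inj
  ; cover  = Sum.swap ∘ cover
  ; c = c ; CA = CB ; CB = CA ; CA-clq = CB-clq ; CB-clq = CA-clq
  ; glue   = ≡.sym ∘ glue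
  ; meet   = λ b a p → Product.map₂ Product.swap (meet a b (≡.sym p))
  ; edgeA  = edgeB ; edgeB = edgeA
  ; edgeG  = λ u v e → Sum.swap (edgeG u v e)
  }
  where open IsCliqueSum cs

module CliqueSumSide {A B G : Graph} (cs : IsCliqueSum A B G) where
  open IsCliqueSum cs

  clique-near : ∀ i j → Near A (CA i) (CA j)
  clique-near i j with i ≟ j
  ... | yes refl = same
  ... | no i≢j   = adjacent (proj₂ CA-clq i j i≢j)

  edge⁻ : ∀ a a' → E G (ιA a) (ιA a') → E A a a'
  edge⁻ a a' e with edgeG _ _ e
  ... | inj₁ (_ , _ , p , q , e') with refl ← ιA-inj p | refl ← ιA-inj q = e'
  ... | inj₂ (b , b' , p , q , _) with meet a b (≡.sym p) | meet a' b' (≡.sym q)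
  ...   | i , refl , _ | i' , refl , _ with i ≟ i'
  ...     | yes refl = ⊥-elim (irref G _ e)
  ...     | no i≢i'  = proj₂ CA-clq i i' i≢i'

  edge-into-clique : ∀ {x a} → ¬ InImage ιA x → E G x (ιA a) → ∃ λ i → a ≡ CA i
  edge-into-clique {x} {a} x∉ e with edgeG x (ιA a) e
  ... | inj₁ (a₀ , _ , p , _)     = ⊥-elim (x∉ (a₀ , p))
  ... | inj₂ (_ , b , _ , q , _) = Product.map₂ proj₁ (meet a b (≡.sym q))

  entry-into-clique : ∀ {x} a → ¬ InImage ιA x → (Z : Walk G x (ιA a)) → MeetsOnlyAtEnd ιA Z →
                      ∃ λ i → a ≡ CA i
  entry-into-clique a x∉ (nil _) _ = ⊥-elim (x∉ (a , refl))
  entry-into-clique a x∉ (cons _ {v} e Z) only with inImage? ιA v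
  ... | no v∉ = entry-into-clique a v∉ Z (only ∘ there)
  ... | yes (b , refl) with refl ← ιA-inj (only (there (source∈ Z)) (b , refl)) = edge-into-clique x∉ e

  -- A walk of G is shortened into A by replacing each excursion into B by (at most) one clique edge.
  mutual
    shadow : ∀ {u} a a' → ιA a ≡ u → (W : Walk G u (ιA a')) → Σ (Walk A a a') λ Wᴬ → Shortcut ιA Wᴬ W
    shadow a a' p (nil _) with refl ← ιA-inj p = nil a , shortcut z≤n λ { (here refl) → here refl }
    shadow a a' refl (cons _ {v} e W) with inImage? ιA v
    ... | yes (b , refl) = near-shortcut (adjacent (edge⁻ a b e)) e (shadow b a' refl W)
    ... | no v∉ with edge-into-clique v∉ (sym G _ _ e) | shadow-outside a' v∉ W
    ...   | i , refl | j , Wᴬ = near-shortcut (clique-near i j) e Wᴬ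

    shadow-outside : ∀ {u} a' → ¬ InImage ιA u → (W : Walk G u (ιA a')) →
                     ∃ λ j → Σ (Walk A (CA j) a') λ Wᴬ → Shortcut ιA Wᴬ W
    shadow-outside a' u∉ (nil _) = ⊥-elim (u∉ (a' , refl))
    shadow-outside a' u∉ (cons _ {v} e W) with inImage? ιA v
    ... | yes (b , refl) with i , refl ← edge-into-clique u∉ e =
      i , Product.map₂ shortcut-there (shadow (CA i) a' refl W)
    ... | no v∉ = Product.map₂ (Product.map₂ shortcut-there) (shadow-outside a' v∉ W)

  side-piece : IsPiece A G ιA
  side-piece = record
    { injective        = ιA-inj
    ; edge⁺            = edgeA
    ; retract          = λ a a' → shadow a a' refl
    ; entries-adjacent = λ c c' x∉ Z only Z' only' →
        clique-entries (entry-into-clique c x∉ Z only) (entry-into-clique c' x∉ Z' only')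
    }
    where
    clique-entries : ∀ {c c'} → ∃ (λ i → c ≡ CA i) → ∃ (λ i → c' ≡ CA i) → Near A c c'
    clique-entries (i , refl) (i' , refl) = clique-near i i'

embed-piece : ∀ {t} {Gs : Fin t → Graph} {S G} (b : Built Gs S G) {i} (m : i ∈ S) → IsPiece (Gs i) G (embed b m)
embed-piece (leaf i) (here refl) = id-piece
embed-piece (csum {S₁ = S₁} b₁ b₂ cs) m with ∈-++⁻ S₁ m
... | inj₁ m₁ = ∘-piece (embed-piece b₁ m₁) (CliqueSumSide.side-piece cs)
... | inj₂ m₂ = ∘-piece (embed-piece b₂ m₂) (CliqueSumSide.side-piece (swap cs))

built-walk : ∀ {t} {Gs : Fin t → Graph} {S G} → Built Gs S G →
             (∀ i u v → Walk (Gs i) u v) → ∀ u v → Walk G u v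
built-walk (leaf i) walk = walk i
built-walk {G = G} (csum b₁ b₂ cs) walk u v = to-hub u ++ᵂ reverse (to-hub v)
  where
  open IsCliqueSum cs
  to-hub : ∀ u → Walk G u (ιA (CA zero))
  to-hub u with cover u
  ... | inj₁ (a , refl) = map-walk G ιA edgeA (built-walk b₁ walk a (CA zero))
  ... | inj₂ (b , refl) =
    subst (Walk G (ιB b)) (≡.sym (glue zero)) (map-walk G ιB edgeB (built-walk b₂ walk b (CB zero)))

module _ {H G : Graph} {ι : V H → V G} (piece : IsPiece H G ι) (walk : ∀ u v → Walk G u v) (y₀ : V H) where
  open IsPiece piece
  open Piece piece
  open Distance walk (ι y₀)
  open Covering G (ι y₀)

  entry-excess : ∀ {x} b (Q : Walk G x (ι b)) → Shortest Q → MeetsOnlyAtEnd ι Q → d (ι b) + len Q ≤ d x + 2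
  entry-excess {x} b Q sh only with inImage? ι x
  ... | yes (a , refl) with refl ← injective (only (source∈ Q) (a , refl)) =
    +-monoʳ-≤ (d (ι a)) (≤-trans (sh (nil _)) z≤n)
  ... | no x∉ with c , Z₁ , Z₂ , only₁ , split ← first-entry ι (reverse (geodesic x)) (y₀ , target∈ _)
    with J , J≤1 ← near-walk (near⁺ (entries-adjacent c b x∉ Z₁ only₁ Q only)) = begin
    d (ι b) + len Q                          ≤⟨ +-mono-≤ (d-minimal (reverse Z₂ ++ᵂ J)) (sh (Z₁ ++ᵂ J)) ⟩
    len (reverse Z₂ ++ᵂ J) + len (Z₁ ++ᵂ J)  ≡⟨ cong₂ _+_ (trans (len-++ (reverse Z₂) J) (cong (_+ len J) (len-reverse Z₂)))
                                                           (len-++ Z₁ J) ⟩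
    (len Z₂ + len J) + (len Z₁ + len J)      ≤⟨ +-mono-≤ (+-monoʳ-≤ (len Z₂) J≤1) (+-monoʳ-≤ (len Z₁) J≤1) ⟩
    (len Z₂ + 1) + (len Z₁ + 1)              ≡⟨ rearrange (len Z₁) (len Z₂) ⟩
    (len Z₁ + len Z₂) + 2                    ≡⟨ cong (_+ 2) (trans (≡.sym (len-++ Z₁ Z₂))
                                                  (trans (cong len (≡.sym split)) (len-reverse (geodesic x)))) ⟩
    d x + 2                                  ∎
    where
    open ≤-Reasoning
    rearrange : ∀ m n → (n + 1) + (m + 1) ≡ (m + n) + 2
    rearrange = solve-∀

  coverable-entry : ∀ {x} b (Q : Walk G x (ι b)) → Shortest Q → MeetsOnlyAtEnd ι Q → CoverableBy G (ι y₀) 3 (verts Q)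
  coverable-entry b Q sh only =
    coverable-⊆ (∈-reverse Q)
      (coverable-by-excess 2 (reverse Q) (subst (λ l → d (ι b) + l ≤ _) (≡.sym (len-reverse Q)) (entry-excess b Q sh only)))

  -- A shortest walk leaving ι(H) at z returns to it at a vertex equal or adjacent to the one it
  -- came from, and cutting out that detour makes it shorter.
  shortest-inside : ∀ a a' (M : Walk G (ι a) (ι a')) → Shortest M → ∀ {z} → z ∈ verts M → InImage ι z
  shortest-inside a a' M sh {z} z∈M with inImage? ι z
  ... | yes z∈ι = z∈ι
  ... | no z∉ with M₁ , M₂ , refl ← splitAt M z∈M
    with c , Z₁ , Z₂ , only , refl ← first-entry ι M₂ (a' , target∈ M₂)
    with c' , Y₁ , Y₂ , only' , split ← first-entry ι (reverse M₁) (a , target∈ (reverse M₁))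
    with J , J≤1 ← near-walk (near⁺ (entries-adjacent c' c z∉ Y₁ only' Z₁ only)) =
    ⊥-elim (n≮n (len (M₁ ++ᵂ Z₁ ++ᵂ Z₂)) (begin-strict
      len (M₁ ++ᵂ Z₁ ++ᵂ Z₂)                   ≤⟨ sh (reverse Y₂ ++ᵂ J ++ᵂ Z₂) ⟩
      len (reverse Y₂ ++ᵂ J ++ᵂ Z₂)            ≡⟨ trans (len-++ (reverse Y₂) _) (cong₂ _+_ (len-reverse Y₂) (len-++ J Z₂)) ⟩
      len Y₂ + (len J + len Z₂)                ≤⟨ +-monoʳ-≤ (len Y₂) (+-monoˡ-≤ (len Z₂) J≤1) ⟩
      len Y₂ + suc (len Z₂)                    <⟨ +-mono-≤ (+-monoˡ-≤ (len Y₂) (len-pos (λ p → z∉ (c' , ≡.sym p)) Y₁))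
                                                            (+-monoˡ-≤ (len Z₂) (len-pos (λ p → z∉ (c , ≡.sym p)) Z₁)) ⟩
      (len Y₁ + len Y₂) + (len Z₁ + len Z₂)    ≡⟨ cong₂ _+_ (trans (≡.sym (len-++ Y₁ Y₂)) (trans (cong len (≡.sym split)) (len-reverse M₁)))
                                                            (≡.sym (len-++ Z₁ Z₂)) ⟩
      len M₁ + len (Z₁ ++ᵂ Z₂)                 ≡⟨ ≡.sym (len-++ M₁ (Z₁ ++ᵂ Z₂)) ⟩
      len (M₁ ++ᵂ Z₁ ++ᵂ Z₂)                   ∎))
    where open ≤-Reasoning

  coverable-inside : ∀ {k} → IpcAtMost H y₀ k → ∀ a a' (M : Walk G (ι a) (ι a')) → Shortest M →
                     CoverableBy G (ι y₀) k (verts M)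
  coverable-inside ipc a a' M sh with Mʰ , len≡ , verts≡ ← lift a a' refl refl M (shortest-inside a a' M sh) =
    subst (CoverableBy G (ι y₀) _) (≡.sym verts≡)
      (coverable-map (ipc (verts Mʰ) (shortest⇒isometric Mʰ (lift-shortest Mʰ M len≡ sh))))

  coverable-through-piece : ∀ {k P x₀} → IpcAtMost H y₀ k → IsIsometric G P → ι x₀ ∈ P →
                            CoverableBy G (ι y₀) (k + 6) P
  coverable-through-piece {k} {x₀ = x₀} ipc iso x₀∈P with _ , _ , W , refl , sh ← isometric⇒shortest {G = G} iso
    with c₁ , Q₁ , W₂ , only₁ , refl ← first-entry ι W (x₀ , x₀∈P)
    with c₂ , Q₂ , M , only₂ , split ← first-entry ι (reverse W₂) (c₁ , target∈ (reverse W₂)) =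
    coverable-⊆ covered
      (coverable-++ (verts M) (coverable-inside ipc c₂ c₁ M (shortest-++ʳ Q₂ M sh-rest))
        (coverable-++ (verts Q₁) (coverable-entry c₁ Q₁ (shortest-++ˡ Q₁ W₂ sh) only₁)
                                 (coverable-entry c₂ Q₂ (shortest-++ˡ Q₂ M sh-rest) only₂)))
    where
    sh-rest : Shortest (Q₂ ++ᵂ M)
    sh-rest = subst Shortest split (shortest-reverse W₂ (shortest-++ʳ Q₁ W₂ sh))
    covered : verts (Q₁ ++ᵂ W₂) ⊆ verts M ++ verts Q₁ ++ verts Q₂
    covered x∈ with ∈-++ᵂ⁻ Q₁ W₂ x∈
    ... | inj₁ x∈Q₁ = ∈-++⁺ʳ (verts M) (∈-++⁺ˡ x∈Q₁)
    ... | inj₂ x∈W₂ with ∈-++ᵂ⁻ Q₂ M (subst (λ R → _ ∈ verts R) split (∈-reverse W₂ x∈W₂))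
    ...   | inj₁ x∈Q₂ = ∈-++⁺ʳ (verts M) (∈-++⁺ʳ (verts Q₁) x∈Q₂)
    ...   | inj₂ x∈M  = ∈-++⁺ˡ x∈M

lemma4p15 : (k t : ℕ) (Gs : Fin t → Graph) →
    (∀ i → Connected (Gs i)) → (∀ i → SipcAtMost (Gs i) k) →
    (G : Graph) (cs : CliqueSumOf Gs G) →
    (P : List (V G)) → IsIsometric G P → (w : V G) →
    (Σ (Fin t) λ i → Σ (i ∈ CliqueSumOf.order cs) λ m →
       (∃ λ x → embed (CliqueSumOf.build cs) m x ∈ P) ×
       (∃ λ y → embed (CliqueSumOf.build cs) m y ≡ w)) →
    CoverableBy G w (k + 6) P
lemma4p15 k t Gs connected sipc G cs P iso w (i , m , (x₀ , x₀∈P) , (y₀ , refl)) =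
  coverable-through-piece (embed-piece build m) (built-walk build (λ j → connected-walk (connected j))) y₀
    (sipc i y₀) iso x₀∈P
  where build = CliqueSumOf.build cs
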